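{- For every integer $n\ge 0$, $m\big(aabab(bbaaba)^n bbaaababb\big)=2n+6$.
   Context: Words are finite strings over the alphabet $\{a,b\}$; $u^n$ is the $n$-fold concatenation of $u$ ($u^0$ empty). A word $a_0\dots a_k$ is a palindrome if $a_i=a_{k-i}$ for all $i\le k$. For a nonempty word $w$, $m(w)$ is the minimal number of nonempty palindromes whose concatenation equals $w$. -}

module Defs where

open import Data.Nat using (ℕ; _≤_)
open import Data.List using (List; []; _∷_; _++_; reverse; concat; length)
open import Data.List.Relation.Unary.All using (All)
open import Data.Product using (Σ; _×_; ∃)
open import Relation.Binary.PropositionalEquality using (_≡_)
open import Relation.Nullary using (¬_)

data Letter : Set where
  a b : Letter

Word : Set
Word = List Letter

_^ʷ_ : Word → ℕ → Word
u ^ʷ ℕ.zero = []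
u ^ʷ ℕ.suc n = u ++ (u ^ʷ n)

Palindrome : Word → Set
Palindrome w = reverse w ≡ w

NonEmpty : Word → Set
NonEmpty w = ¬ (w ≡ [])

PalFactorization : Word → List Word → Set
PalFactorization w ps = All (λ p → NonEmpty p × Palindrome p) ps × concat ps ≡ w

MinPal : Word → ℕ → Set
MinPal w k =
  (Σ (List Word) λ ps → PalFactorization w ps × length ps ≡ k)
  × (∀ (ps : List Word) → PalFactorization w ps → k ≤ length ps)

module Submission where

-- Upper bound: an explicit factorization into 2n + 6 palindromes, four
-- palindromes for every two periods bbaaba.
--
-- Lower bound, in three general steps.
-- (1) A palindrome of length ≥ m has a central palindromic factor of length
--     m or m + 1, so a word none of whose factors of length 6 or 7 is a
--     palindrome (a finite, position-by-position Boolean check) has only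
--     palindromic factors of length ≤ 5.
-- (2) For such words a dynamic programme that only tries first pieces of
--     length ≤ K + 1 (here K = 4) computes a lower bound for the length of
--     every palindromic factorization.  Its table at a position depends only
--     on the next K + 1 letters and the table at the K + 1 following positions.
-- (3) Hence the table is shift-equivariant: if the tables of two words that
--     start with the same ≥ K letters differ by a constant c, then so do the
--     tables after prepending any common prefix.  Since the table for two
--     periods exceeds that for one period by 2 (a finite computation), each
--     period adds exactly 2, and the whole word gets value 2n + 6.

open import Defs
open import Data.Bool using (Bool; true; T; _∧_)
open import Data.Empty using (⊥; ⊥-elim)
open import Data.List using (List; []; _∷_; _++_; reverse; concat; length; take; _∷ʳ_; initLast; _∷ʳ′_)
open import Data.List.Properties
  using (++-assoc; ++-identityʳ; take-take; unfold-reverse; reverse-++; ∷ʳ-injectiveˡ; ∷-injectiveʳ; length-++-≤ʳ; ≡-dec)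
open import Data.List.Relation.Unary.All using (All; []; _∷_)
open import Data.Nat using (ℕ; zero; suc; _+_; _*_; _∸_; _≤_; _⊓_; z≤n; s≤s; _≟_; _≤?_)
open import Data.Nat.Properties
  using (≤-refl; ≤-trans; n≤1+n; ≤-pred; ≰⇒>; m⊓n≤m; m⊓n≤n; m≤n⇒m⊓n≡m; m≤n⇒m<n∨m≡n; m∸n+n≡m; +-distribˡ-⊓; +-suc; *-suc; suc-injective)
open import Data.Bool.Properties using (T-∧)
open import Data.Product using (Σ; _×_; _,_; proj₁; proj₂)
open import Data.Sum using (_⊎_; inj₁; inj₂)
open import Function.Bundles using (Equivalence)
open import Relation.Binary.Definitions using (DecidableEquality)
open import Relation.Binary.PropositionalEquality using (_≡_; refl; sym; trans; cong; cong₂; subst; module ≡-Reasoning)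
open import Relation.Nullary using (Dec; yes; no; ¬_)
open import Relation.Nullary.Decidable using (isNo; toWitnessFalse; _×-dec_; _⊎-dec_)

open ≡-Reasoning

_≟ᴸ_ : DecidableEquality Letter
a ≟ᴸ a = yes refl
a ≟ᴸ b = no λ ()
b ≟ᴸ a = no λ ()
b ≟ᴸ b = yes refl

palindrome? : (w : Word) → Dec (Palindrome w)
palindrome? w = ≡-dec _≟ᴸ_ (reverse w) w

palindrome-inner : ∀ x q y → Palindrome (x ∷ (q ∷ʳ y)) → Palindrome q
palindrome-inner x q y pal = ∷ʳ-injectiveˡ (reverse q) q (∷-injectiveʳ reversed)
  where
  reversed : y ∷ (reverse q ∷ʳ x) ≡ x ∷ (q ∷ʳ y)
  reversed = begin
    y ∷ (reverse q ∷ʳ x)    ≡⟨ cong (_∷ʳ x) (sym (reverse-++ q (y ∷ []))) ⟩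
    reverse (q ∷ʳ y) ∷ʳ x   ≡⟨ sym (unfold-reverse x (q ∷ʳ y)) ⟩
    reverse (x ∷ (q ∷ʳ y))  ≡⟨ pal ⟩
    x ∷ (q ∷ʳ y)            ∎

Factor : Word → Word → Set
Factor q w = Σ Word λ u → Σ Word λ v → u ++ q ++ v ≡ w

factor-trans : ∀ {q p w} → Factor q p → Factor p w → Factor q w
factor-trans {q} (u′ , v′ , refl) (u , v , refl) = u ++ u′ , v′ ++ v , regroup
  where
  regroup : (u ++ u′) ++ q ++ v′ ++ v ≡ u ++ (u′ ++ q ++ v′) ++ v
  regroup = begin
    (u ++ u′) ++ q ++ v′ ++ v    ≡⟨ ++-assoc u u′ (q ++ v′ ++ v) ⟩
    u ++ u′ ++ q ++ v′ ++ v      ≡⟨ cong (λ z → u ++ u′ ++ z) (sym (++-assoc q v′ v)) ⟩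
    u ++ u′ ++ (q ++ v′) ++ v    ≡⟨ cong (u ++_) (sym (++-assoc u′ (q ++ v′) v)) ⟩
    u ++ (u′ ++ q ++ v′) ++ v    ∎

suffix-factor : ∀ u s → Factor s (u ++ s)
suffix-factor u s = u , [] , cong (u ++_) (++-identityʳ s)

length-snoc : ∀ (q : Word) y → length (q ∷ʳ y) ≡ suc (length q)
length-snoc []      y = refl
length-snoc (x ∷ q) y = cong suc (length-snoc q y)

central-palindrome : ∀ m d p → length p ≡ d + m → Palindrome p →
                     Σ Word λ q → Factor q p × Palindrome q × (length q ≡ m ⊎ length q ≡ suc m)
central-palindrome m zero          p       len pal = p , ([] , [] , ++-identityʳ p) , pal , inj₁ len
central-palindrome m (suc zero)    p       len pal = p , ([] , [] , ++-identityʳ p) , pal , inj₂ len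
central-palindrome m (suc (suc d)) (x ∷ t) len pal with initLast t
... | q ∷ʳ′ y
  with central-palindrome m d q (suc-injective (trans (sym (length-snoc q y)) (suc-injective len)))
                          (palindrome-inner x q y pal)
...   | r , r-in-q , pal-r , len-r = r , factor-trans r-in-q (x ∷ [] , y ∷ [] , refl) , pal-r , len-r
central-palindrome m (suc (suc d)) (x ∷ .[]) () pal | []

PalBounded : ℕ → Word → Set
PalBounded L w = ∀ {p} → Factor p w → Palindrome p → length p ≤ L

bounded-suffix : ∀ {L} u {s} → PalBounded L (u ++ s) → PalBounded L s
bounded-suffix u {s} bounded p-in-s pal = bounded (factor-trans p-in-s (suffix-factor u s)) pal

PalPrefix : ℕ → Word → Set
PalPrefix n w = length (take n w) ≡ n × Palindrome (take n w)

palPrefix? : ∀ n w → Dec (PalPrefix n w)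
palPrefix? n w = (length (take n w) ≟ n) ×-dec palindrome? (take n w)

take-length-++ : ∀ (q r : Word) → take (length q) (q ++ r) ≡ q
take-length-++ []      r = refl
take-length-++ (x ∷ q) r = cong (x ∷_) (take-length-++ q r)

palindrome-prefix : ∀ q r → Palindrome q → PalPrefix (length q) (q ++ r)
palindrome-prefix q r pal rewrite take-length-++ q r = refl , pal

-- It is computed position by position, so it evaluates on
-- words with a symbolic tail as soon as the windows are concrete.
noPal : ℕ → Word → Bool
noPal m []      = true
noPal m (x ∷ w) = isNo (palPrefix? m (x ∷ w) ⊎-dec palPrefix? (suc m) (x ∷ w)) ∧ noPal m w

noPal-split : ∀ m x w → T (noPal m (x ∷ w)) →
              ¬ (PalPrefix m (x ∷ w) ⊎ PalPrefix (suc m) (x ∷ w)) × T (noPal m w)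
noPal-split m x w check
  with Equivalence.to (T-∧ {isNo (palPrefix? m (x ∷ w) ⊎-dec palPrefix? (suc m) (x ∷ w))}) check
... | here , rest = toWitnessFalse here , rest

noPal-sound : ∀ m w {q} → T (noPal (suc m) w) → Factor q w → Palindrome q →
              length q ≡ suc m ⊎ length q ≡ suc (suc m) → ⊥
noPal-sound m .((x ∷ q) ++ v) {x ∷ q} check ([] , v , refl) pal len = proj₁ (noPal-split (suc m) x (q ++ v) check) (prefix len)
  where
  prefix : length (x ∷ q) ≡ suc m ⊎ length (x ∷ q) ≡ suc (suc m) →
           PalPrefix (suc m) (x ∷ q ++ v) ⊎ PalPrefix (suc (suc m)) (x ∷ q ++ v)
  prefix (inj₁ e) = inj₁ (subst (λ n → PalPrefix n (x ∷ q ++ v)) e (palindrome-prefix (x ∷ q) v pal))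
  prefix (inj₂ e) = inj₂ (subst (λ n → PalPrefix n (x ∷ q ++ v)) e (palindrome-prefix (x ∷ q) v pal))
noPal-sound m _ {[]} _ ([] , _ , _) _ (inj₁ ())
noPal-sound m _ {[]} _ ([] , _ , _) _ (inj₂ ())
noPal-sound m .(y ∷ u ++ q ++ v) {q} check (y ∷ u , v , refl) pal len =
  noPal-sound m (u ++ q ++ v) (proj₂ (noPal-split (suc m) y (u ++ q ++ v) check)) (u , v , refl) pal len

-- Passing the check for lengths L + 1 and L + 2 bounds all palindromic
-- factors by L, since a longer one would contain a central one of those lengths.
noPal⇒bounded : ∀ L w → T (noPal (suc L) w) → PalBounded L w
noPal⇒bounded L w check {p} p-in-w pal with suc L ≤? length p
... | no short = ≤-pred (≰⇒> short)
... | yes long with central-palindrome (suc L) (length p ∸ suc L) p (sym (m∸n+n≡m long)) pal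
...   | q , q-in-p , pal-q , len-q = ⊥-elim (noPal-sound L w check (factor-trans q-in-p p-in-w) pal-q len-q)

take-++-within : ∀ n (w v v′ : Word) → n ≤ length w → take n (w ++ v) ≡ take n (w ++ v′)
take-++-within zero    w       v v′ _         = refl
take-++-within (suc n) (x ∷ w) v v′ (s≤s n≤w) = cong (x ∷_) (take-++-within n w v v′ n≤w)

take-prefix : ∀ n q r → length q ≤ n → take (length q) (take n (q ++ r)) ≡ q
take-prefix n q r q≤n = begin
  take (length q) (take n (q ++ r))  ≡⟨ take-take (length q) n (q ++ r) ⟩
  take (length q ⊓ n) (q ++ r)       ≡⟨ cong (λ k → take k (q ++ r)) (m≤n⇒m⊓n≡m q≤n) ⟩
  take (length q) (q ++ r)           ≡⟨ take-length-++ q r ⟩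
  q                                  ∎

module WindowCost (K : ℕ) where

  -- best u j f: the least f i over those i ≤ j for which the first i + 1
  -- letters of u form a palindrome (i = 0 is always admitted).
  best : Word → ℕ → (ℕ → ℕ) → ℕ
  best u zero    f = f 0
  best u (suc j) f with palindrome? (take (suc (suc j)) u)
  ... | yes _ = best u j f ⊓ f (suc j)
  ... | no  _ = best u j f

  best-≤ : ∀ {u f i} j → Palindrome (take (suc i) u) → i ≤ j → best u j f ≤ f i
  best-≤             zero    pal z≤n = ≤-refl
  best-≤ {u} {f} {i} (suc j) pal i≤j+1
    with palindrome? (take (suc (suc j)) u) | m≤n⇒m<n∨m≡n i≤j+1
  ... | yes _   | inj₁ (s≤s i≤j) = ≤-trans (m⊓n≤m _ _) (best-≤ j pal i≤j)
  ... | yes _   | inj₂ refl      = m⊓n≤n _ _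
  ... | no _    | inj₁ (s≤s i≤j) = best-≤ j pal i≤j
  ... | no ¬pal | inj₂ refl      = ⊥-elim (¬pal pal)

  best-shift : ∀ u c {f g} j → (∀ i → i ≤ j → f i ≡ c + g i) → best u j f ≡ c + best u j g
  best-shift u c         zero    shift = shift 0 z≤n
  best-shift u c {f} {g} (suc j) shift with palindrome? (take (suc (suc j)) u)
  ... | yes _ = begin
    best u j f ⊓ f (suc j)               ≡⟨ cong₂ _⊓_ (best-shift u c j shift′) (shift (suc j) ≤-refl) ⟩
    (c + best u j g) ⊓ (c + g (suc j))   ≡⟨ sym (+-distribˡ-⊓ c (best u j g) (g (suc j))) ⟩
    c + (best u j g ⊓ g (suc j))         ∎
    where
    shift′ : ∀ i → i ≤ j → f i ≡ c + g i
    shift′ i i≤j = shift i (≤-trans i≤j (n≤1+n j))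
  ... | no _ = best-shift u c j (λ i i≤j → shift i (≤-trans i≤j (n≤1+n j)))

  -- cost s i is the value of the programme on the suffix of s after i letters;
  -- a first piece is only tried among the first K + 1 letters.
  cost : Word → ℕ → ℕ
  cost []      i       = 0
  cost (x ∷ s) zero    = suc (best (take (suc K) (x ∷ s)) K (cost s))
  cost (x ∷ s) (suc i) = cost s i

  cost-skip : ∀ q r → cost (q ++ r) (length q) ≡ cost r 0
  cost-skip []      r = refl
  cost-skip (x ∷ q) r = cost-skip q r

  cost-lower-bound : ∀ w ps → PalBounded (suc K) w → PalFactorization w ps → cost w 0 ≤ length ps
  cost-lower-bound .[] [] _ ([] , refl) = z≤n
  cost-lower-bound _ ([] ∷ ps) _ ((nonEmpty , _) ∷ _ , _) = ⊥-elim (nonEmpty refl)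
  cost-lower-bound .((x ∷ q) ++ concat ps) ((x ∷ q) ∷ ps) bounded ((_ , pal) ∷ pieces , refl) =
    s≤s (≤-trans (best-≤ K pal-window q≤K) (subst (_≤ length ps) (sym (cost-skip q r)) rest-bound))
    where
    r : Word
    r = concat ps
    q+1≤K+1 : suc (length q) ≤ suc K
    q+1≤K+1 = bounded ([] , r , refl) pal
    q≤K : length q ≤ K
    q≤K = ≤-pred q+1≤K+1
    pal-window : Palindrome (take (suc (length q)) (take (suc K) (x ∷ q ++ r)))
    pal-window = subst Palindrome (sym (take-prefix (suc K) (x ∷ q) r q+1≤K+1)) pal
    rest-bound : cost r 0 ≤ length ps
    rest-bound = cost-lower-bound r ps (bounded-suffix (x ∷ q) bounded) (pieces , refl)

  -- Shift-equivariance: the first K + 1 table entries of x ++ y depend only on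
  -- x, the first K letters of y and the first K + 1 table entries of y.
  cost-shift : ∀ c x u v v′ → K ≤ length u →
               (∀ i → i ≤ K → cost (u ++ v) i ≡ c + cost (u ++ v′) i) →
               ∀ i → i ≤ K → cost (x ++ u ++ v) i ≡ c + cost (x ++ u ++ v′) i
  cost-shift c []      u v v′ long shift = shift
  cost-shift c (y ∷ x) u v v′ long shift (suc i) i+1≤K =
    cost-shift c x u v v′ long shift i (≤-trans (n≤1+n i) i+1≤K)
  cost-shift c (y ∷ x) u v v′ long shift zero _ = begin
    suc (best (y ∷ take K (x ++ u ++ v)) K (cost (x ++ u ++ v)))
      ≡⟨ cong (λ window → suc (best (y ∷ window) K (cost (x ++ u ++ v)))) same-window ⟩
    suc (best (y ∷ take K (x ++ u ++ v′)) K (cost (x ++ u ++ v)))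
      ≡⟨ cong suc (best-shift _ c K (cost-shift c x u v v′ long shift)) ⟩
    suc (c + best (y ∷ take K (x ++ u ++ v′)) K (cost (x ++ u ++ v′)))
      ≡⟨ sym (+-suc c _) ⟩
    c + suc (best (y ∷ take K (x ++ u ++ v′)) K (cost (x ++ u ++ v′)))  ∎
    where
    same-window : take K (x ++ u ++ v) ≡ take K (x ++ u ++ v′)
    same-window = begin
      take K (x ++ u ++ v)    ≡⟨ cong (take K) (sym (++-assoc x u v)) ⟩
      take K ((x ++ u) ++ v)  ≡⟨ take-++-within K (x ++ u) v v′ (≤-trans long (length-++-≤ʳ u {x})) ⟩
      take K ((x ++ u) ++ v′) ≡⟨ cong (take K) (++-assoc x u v′) ⟩
      take K (x ++ u ++ v′)   ∎

open WindowCost 4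

opening period ending : Word
opening = a ∷ a ∷ b ∷ a ∷ b ∷ []
period  = b ∷ b ∷ a ∷ a ∷ b ∷ a ∷ []
ending  = b ∷ b ∷ a ∷ a ∷ a ∷ b ∷ a ∷ b ∷ b ∷ []

body : ℕ → Word
body n = (period ^ʷ n) ++ ending

word : ℕ → Word
word n = opening ++ body n

period-step : ∀ k c → 2 * suc k + c ≡ 2 + (2 * k + c)
period-step k c = cong (_+ c) (*-suc 2 k)

two-more : ∀ k c → 2 * k + (2 + c) ≡ 2 * suc k + c
two-more k c = begin
  2 * k + (2 + c)        ≡⟨ +-suc (2 * k) (suc c) ⟩
  suc (2 * k + suc c)    ≡⟨ cong suc (+-suc (2 * k) c) ⟩
  2 + (2 * k + c)        ≡⟨ sym (period-step k c) ⟩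
  2 * suc k + c          ∎

bodyTail : ℕ → List Word
bodyTail zero          = (b ∷ a ∷ a ∷ a ∷ b ∷ []) ∷ (a ∷ []) ∷ (b ∷ b ∷ []) ∷ []
bodyTail (suc zero)    = (b ∷ a ∷ a ∷ b ∷ []) ∷ (a ∷ b ∷ b ∷ a ∷ []) ∷ (a ∷ []) ∷ (a ∷ b ∷ a ∷ []) ∷ (b ∷ b ∷ []) ∷ []
bodyTail (suc (suc n)) = (b ∷ a ∷ a ∷ b ∷ []) ∷ (a ∷ b ∷ b ∷ a ∷ []) ∷ (a ∷ []) ∷ (b ∷ a ∷ b ∷ []) ∷ bodyTail n

bodyTail-concat : ∀ n → b ∷ concat (bodyTail n) ≡ body n
bodyTail-concat zero          = refl
bodyTail-concat (suc zero)    = refl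
bodyTail-concat (suc (suc n)) = cong (λ w → b ∷ b ∷ a ∷ a ∷ b ∷ a ∷ b ∷ b ∷ a ∷ a ∷ b ∷ a ∷ w) (bodyTail-concat n)

bodyTail-palindromes : ∀ n → All (λ p → NonEmpty p × Palindrome p) (bodyTail n)
bodyTail-palindromes zero          = ((λ ()) , refl) ∷ ((λ ()) , refl) ∷ ((λ ()) , refl) ∷ []
bodyTail-palindromes (suc zero)    =
  ((λ ()) , refl) ∷ ((λ ()) , refl) ∷ ((λ ()) , refl) ∷ ((λ ()) , refl) ∷ ((λ ()) , refl) ∷ []
bodyTail-palindromes (suc (suc n)) =
  ((λ ()) , refl) ∷ ((λ ()) , refl) ∷ ((λ ()) , refl) ∷ ((λ ()) , refl) ∷ bodyTail-palindromes n

-- Together with a, aba, bb in front this gives 2n + 6 pieces.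
bodyTail-length : ∀ n → 3 + length (bodyTail n) ≡ 2 * n + 6
bodyTail-length zero          = refl
bodyTail-length (suc zero)    = refl
bodyTail-length (suc (suc n)) = begin
  3 + length (bodyTail (suc (suc n)))  ≡⟨ cong (4 +_) (bodyTail-length n) ⟩
  2 + (2 + (2 * n + 6))                ≡⟨ cong (2 +_) (sym (period-step n 6)) ⟩
  2 + (2 * suc n + 6)                  ≡⟨ sym (period-step (suc n) 6) ⟩
  2 * suc (suc n) + 6                  ∎

word-factorization : ∀ n → Σ (List Word) λ ps → PalFactorization (word n) ps × length ps ≡ 2 * n + 6
word-factorization n =
  (a ∷ []) ∷ (a ∷ b ∷ a ∷ []) ∷ (b ∷ b ∷ []) ∷ bodyTail n
  , (((λ ()) , refl) ∷ ((λ ()) , refl) ∷ ((λ ()) , refl) ∷ bodyTail-palindromes n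
    , cong (λ w → a ∷ a ∷ b ∷ a ∷ b ∷ w) (bodyTail-concat n))
  , bodyTail-length n

-- No factor of length 6 or 7 is a palindrome; the check is local, so one
-- period followed by any body behaves like one period followed by a period.
noPal-body : ∀ n → T (noPal 6 (body n))
noPal-body zero          = _
noPal-body (suc zero)    = _
noPal-body (suc (suc n)) = noPal-body (suc n)

word-bounded : ∀ n → PalBounded 5 (word n)
word-bounded zero    = noPal⇒bounded 5 (word zero) _
word-bounded (suc n) = noPal⇒bounded 5 (word (suc n)) (noPal-body (suc n))

two-periods : ∀ i → i ≤ 4 → cost (body 2) i ≡ 2 + cost (body 1) i
two-periods 0 _ = refl
two-periods 1 _ = refl
two-periods 2 _ = refl
two-periods 3 _ = refl
two-periods 4 _ = refl
two-periods (suc (suc (suc (suc (suc _))))) (s≤s (s≤s (s≤s (s≤s ()))))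

-- A period is long enough to hide what follows it from the window of size 4.
period-long : 4 ≤ length period
period-long = s≤s (s≤s (s≤s (s≤s z≤n)))

body-cost : ∀ k i → i ≤ 4 → cost (body (suc k)) i ≡ 2 * k + cost (body 1) i
body-cost zero    i _    = refl
body-cost (suc k) i i≤4 = begin
  cost (period ++ period ++ body k) i  ≡⟨ cost-shift (2 * k) period period (body k) ending period-long (body-cost k) i i≤4 ⟩
  2 * k + cost (body 2) i              ≡⟨ cong (2 * k +_) (two-periods i i≤4) ⟩
  2 * k + (2 + cost (body 1) i)        ≡⟨ two-more k (cost (body 1) i) ⟩
  2 * suc k + cost (body 1) i          ∎

word-cost : ∀ n → cost (word n) 0 ≡ 2 * n + 6
word-cost zero    = refl
word-cost (suc k) = begin
  cost (opening ++ period ++ body k) 0  ≡⟨ cost-shift (2 * k) opening period (body k) ending period-long (body-cost k) 0 z≤n ⟩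
  2 * k + (2 + 6)                      ≡⟨ two-more k 6 ⟩
  2 * suc k + 6                        ∎

lemma9 : (n : ℕ) →
    MinPal ((a ∷ a ∷ b ∷ a ∷ b ∷ []) ++ ((b ∷ b ∷ a ∷ a ∷ b ∷ a ∷ []) ^ʷ n) ++ (b ∷ b ∷ a ∷ a ∷ a ∷ b ∷ a ∷ b ∷ b ∷ []))
           (2 * n + 6)
lemma9 n = word-factorization n , lower-bound
  where
  lower-bound : ∀ ps → PalFactorization (word n) ps → 2 * n + 6 ≤ length ps
  lower-bound ps fac = subst (_≤ length ps) (word-cost n) (cost-lower-bound (word n) ps (word-bounded n) fac)
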